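{- Let $\pi_1,\pi_2,\pi_3$ be permutations of $\mathbb{F}_2^m$ having the $(\mathcal{A}_m)$ property, and let $\sigma_1,\sigma_2,\sigma_3$ be permutations of $\mathbb{F}_2^m$ having the $(\mathcal{A}_m)$ property. Put $\pi_4=\pi_1+\pi_2+\pi_3$, $\sigma_4=\sigma_1+\sigma_2+\sigma_3$, and let $h_i,g_i$ ($i=1,2,3,4$) be Boolean functions on $\mathbb{F}_2^m$ such that for all $y\in\mathbb{F}_2^m$ $$\sum_{i=1}^4 h_i(\pi_i^{ -1}(y))=1\quad\text{and}\quad \sum_{i=1}^4 g_i(\sigma_i^{ -1}(y))=1.$$ For $i\in\{1,2,3,4\}$ define permutations $\phi_i$ of $\mathbb{F}_2^{m+1}$ by $\phi_i(y,y_{m+1})=(\pi_i(y),1)$ if $y_{m+1}=1$ and $\phi_i(y,y_{m+1})=(\sigma_i(y),0)$ if $y_{m+1}=0$, and Boolean functions $h_i'$ on $\mathbb{F}_2^{m+1}$ by $h_i'(y,y_{m+1})=y_{m+1}h_i(y)+(y_{m+1}+1)g_i(y)$. Then: 1. $\phi_4=\phi_1+\phi_2+\phi_3$ and $\sum_{i=1}^4 h_i'(\phi_i^{ -1}(y,y_{m+1}))=1$ for all $y\in\mathbb{F}_2^m$, $y_{m+1}\in\mathbb{F}_2$; 2. the Boolean functions $f_i'(x',y')=x'\cdot\phi_i(y')+h_i'(y')$, $x',y'\in\mathbb{F}_2^{m+1}$, $i\in\{1,2,3,4\}$, are bent, and the concatenation $f_1'\|f_2'\|f_3'\|f_4'$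 is a bent function in $2m+4$ variables.
   Context: Three permutations $\tau_1,\tau_2,\tau_3$ of $\mathbb{F}_2^k$ have the $(\mathcal{A}_k)$ property if $\tau_4=\tau_1+\tau_2+\tau_3$ is a permutation and $\tau_4^{ -1}=\tau_1^{ -1}+\tau_2^{ -1}+\tau_3^{ -1}$. $x'\cdot w$ denotes the standard inner product on $\mathbb{F}_2^{m+1}$. A Boolean function $g$ on $\mathbb{F}_2^N$ ($N$ even) is bent if $W_g(a)=\sum_{z}(-1)^{g(z)+a\cdot z}=\pm2^{N/2}$ for all $a\in\mathbb{F}_2^N$. For $g_1,\dots,g_4$ on $\mathbb{F}_2^N$, the concatenation $g_1\|g_2\|g_3\|g_4$ is the function on $\mathbb{F}_2^{N+2}$ given by $(z,z_{N+1},z_{N+2})\mapsto g_1(z)+z_{N+1}(g_1+g_3)(z)+z_{N+2}(g_1+g_2)(z)+z_{N+1}z_{N+2}(g_1+g_2+g_3+g_4)(z)$. -}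

module Defs where

open import Data.Bool using (Bool; true; false; _xor_; _∧_; if_then_else_)
open import Data.Nat using (ℕ; zero; suc; _+_; _^_; ⌊_/2⌋)
open import Data.Integer using (ℤ; +_; -_) renaming (_+_ to _+ℤ_)
open import Data.Fin using (zero; suc)
open import Data.Vec using (Vec; []; _∷_; _∷ʳ_; zipWith; foldr; init; last; initLast; take; drop; lookup)
open import Data.Vec.Properties using (init-∷ʳ; last-∷ʳ)
open import Data.List using (List; [_]; _++_; map) renaming (foldr to lfoldr)
open import Data.Product using (Σ; Σ-syntax; _×_; _,_; proj₁; proj₂)
open import Data.Sum using (_⊎_)
open import Function.Bundles using (_↔_; Inverse; mk↔ₛ′)
open import Relation.Binary.PropositionalEquality using (_≡_; refl; sym; trans; cong)

V : ℕ → Set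
V k = Vec Bool k

infixl 6 _⊕_
_⊕_ : ∀ {k} → V k → V k → V k
_⊕_ = zipWith _xor_

_·_ : ∀ {k} → V k → V k → Bool
x · y = foldr _ _xor_ false (zipWith _∧_ x y)

Perm : ℕ → Set
Perm k = V k ↔ V k

module _ {k : ℕ} where
  open Inverse

  -- (A_k) property: tau4 = tau1+tau2+tau3 is a permutation (tau4 is the
  -- witnessing permutation, whose forward map is the pointwise sum) and
  -- tau4^{-1} = tau1^{-1}+tau2^{-1}+tau3^{-1}.
  PropertyA : Perm k → Perm k → Perm k → Set
  PropertyA τ₁ τ₂ τ₃ =
    Σ[ τ₄ ∈ Perm k ]
      ((∀ x → to τ₄ x ≡ to τ₁ x ⊕ to τ₂ x ⊕ to τ₃ x)
      × (∀ y → from τ₄ y ≡ from τ₁ y ⊕ from τ₂ y ⊕ from τ₃ y))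

-- Elements of F_2^{m+1} are written (y, y_{m+1}) = y ∷ʳ y_{m+1}
-- (the extra coordinate is the LAST one).
step : ∀ {m} → (V m → V m) → (V m → V m) → Bool → V m → V (suc m)
step f g true  y = f y ∷ʳ true
step f g false y = g y ∷ʳ false

glueFun : ∀ {m} → (V m → V m) → (V m → V m) → V (suc m) → V (suc m)
glueFun f g w = step f g (last w) (init w)

private
  pick : ∀ {m} → Bool → (V m → V m) → (V m → V m) → V m → V m
  pick true  f g y = f y
  pick false f g y = g y

  L1 : ∀ {m} (f g f' g' : V m → V m) b y →
       glueFun f' g' (step f g b y) ≡ step f' g' b (pick b f g y)
  L1 f g f' g' true y rewrite last-∷ʳ true (f y) | init-∷ʳ true (f y) = refl
  L1 f g f' g' false y rewrite last-∷ʳ false (g y) | init-∷ʳ false (g y) = refl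

  L2 : ∀ {m} (f g f' g' : V m → V m) →
       (∀ y → f' (f y) ≡ y) → (∀ y → g' (g y) ≡ y) →
       ∀ b y → step f' g' b (pick b f g y) ≡ y ∷ʳ b
  L2 f g f' g' p q true y = cong (_∷ʳ true) (p y)
  L2 f g f' g' p q false y = cong (_∷ʳ false) (q y)

  glueInv : ∀ {m} (f g f' g' : V m → V m) →
            (∀ y → f' (f y) ≡ y) → (∀ y → g' (g y) ≡ y) →
            ∀ w → glueFun f' g' (glueFun f g w) ≡ w
  glueInv f g f' g' p q w =
    trans (L1 f g f' g' (last w) (init w))
      (trans (L2 f g f' g' p q (last w) (init w))
             (sym (proj₂ (proj₂ (initLast w)))))

glue : ∀ {m} → Perm m → Perm m → Perm (suc m)
glue π σ = mk↔ₛ′ (glueFun (to π) (to σ)) (glueFun (from π) (from σ))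
  (glueInv (from π) (from σ) (to π) (to σ) (strictlyInverseˡ π) (strictlyInverseˡ σ))
  (glueInv (to π) (to σ) (from π) (from σ) (strictlyInverseʳ π) (strictlyInverseʳ σ))
  where open Inverse

liftFun : ∀ {m} → (V m → Bool) → (V m → Bool) → V (suc m) → Bool
liftFun h g w = (last w ∧ h (init w)) xor ((last w xor true) ∧ g (init w))

mmFun : ∀ {n} → (V n → V n) → (V n → Bool) → V (n + n) → Bool
mmFun {n} φ h z = (take n z · φ (drop n z)) xor h (drop n z)

-- Concatenation g1 || g2 || g3 || g4 on F_2^{N+2}, variables
-- (z, z_{N+1}, z_{N+2}).
concat4 : ∀ {N} → (g₁ g₂ g₃ g₄ : V N → Bool) → V (N + 2) → Bool
concat4 {N} g₁ g₂ g₃ g₄ w =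
  g₁ z xor (a ∧ (g₁ z xor g₃ z)) xor (b ∧ (g₁ z xor g₂ z))
       xor ((a ∧ b) ∧ (g₁ z xor g₂ z xor g₃ z xor g₄ z))
  where
    z = take N w
    t = drop N w
    a = lookup t zero
    b = lookup t (suc zero)

allVecs : (N : ℕ) → List (V N)
allVecs zero = [ [] ]
allVecs (suc N) = map (false ∷_) (allVecs N) ++ map (true ∷_) (allVecs N)

sgn : Bool → ℤ
sgn false = + 1
sgn true  = - (+ 1)

walsh : ∀ {N} → (V N → Bool) → V N → ℤ
walsh {N} g a = lfoldr (λ z s → sgn (g z xor (a · z)) +ℤ s) (+ 0) (allVecs N)

-- Bent (N even in all uses): W_g(a) = ± 2^{N/2} for all a.
Bent : (N : ℕ) → (V N → Bool) → Set
Bent N g = ∀ a → walsh g a ≡ + (2 ^ ⌊ N /2⌋) ⊎ walsh g a ≡ - (+ (2 ^ ⌊ N /2⌋))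

-- Each f′ᵢ is a Maiorana–McFarland function x · φ(y) + h(y) with φ a permutation, hence bent
-- with dual f̃(α, β) = h(φ⁻¹ α) + β · φ⁻¹(α).  The Walsh transform of g₁ ‖ g₂ ‖ g₃ ‖ g₄ at
-- (α, c₁, c₂) is W₁(α) + (-1)^{c₂} W₂(α) + (-1)^{c₁} W₃(α) + (-1)^{c₁+c₂} W₄(α); for bent gᵢ this
-- is 2ⁿ times a sum of four signs with product (-1)^{g̃₁+g̃₂+g̃₃+g̃₄}, and four signs with product -1
-- sum to ±2.  So the concatenation is bent as soon as the duals sum to 1.  For the glued φᵢ this
-- holds because φ₄⁻¹ = φ₁⁻¹ + φ₂⁻¹ + φ₃⁻¹ kills the linear parts β · φᵢ⁻¹(α), while the parts
-- h′ᵢ(φᵢ⁻¹ α) sum to 1 on each half y_{m+1} = 0, 1 of the space by the hypotheses on hᵢ and gᵢ.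
module Submission where

open import Defs
open import Algebra.Bundles using (CommutativeRing)
open import Data.Bool using (Bool; true; false; _xor_; _∧_; not)
open import Data.Bool.Properties
  using (xor-assoc; xor-same; xor-identityʳ; ∧-comm; ∧-distribˡ-xor; xor-∧-commutativeRing)
open import Data.Empty using (⊥-elim)
open import Data.Integer using (ℤ; +_; -_) renaming (_+_ to _+ℤ_; _*_ to _*ℤ_)
open import Data.Integer.Properties
  using (+-identityˡ; +-identityʳ; +-assoc; *-distribˡ-+; pos-+; pos-*; *-comm; *-identityˡ; *-identityʳ; *-zeroʳ; neg-distribʳ-*)
open import Data.Integer.Tactic.RingSolver using (solve-∀)
open import Data.List using (List; []; _∷_; foldr; map) renaming (_++_ to _++ᴸ_)
open import Data.Nat using (ℕ; zero; suc; _+_; _^_; ⌊_/2⌋)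
import Data.Nat.Properties as ℕ
open import Data.Product using (_×_; _,_; proj₁; proj₂)
open import Data.Sum using (_⊎_; inj₁; inj₂) renaming (map to map⊎)
open import Data.Vec using ([]; _∷_; _∷ʳ_; _++_; take; drop; init; last; splitAt)
open import Data.Vec.Properties using (init-∷ʳ; last-∷ʳ; ∷-injectiveʳ)
open import Function using (_∘_)
open import Function.Bundles using (Inverse)
open import Relation.Binary.PropositionalEquality
  using (_≡_; _≢_; refl; sym; trans; cong; cong₂; module ≡-Reasoning)

open Inverse using (to; from; strictlyInverseˡ; strictlyInverseʳ)
open ≡-Reasoning

open import Algebra.Properties.CommutativeSemigroup
  (CommutativeRing.+-commutativeSemigroup xor-∧-commutativeRing)
  using (interchange; xy∙z≈y∙xz)

xor-cancelˡ : ∀ x y → x xor (x xor y) ≡ y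
xor-cancelˡ x y = trans (sym (xor-assoc x x y)) (cong (_xor y) (xor-same x))

xor-interchange₄ : ∀ a₁ b₁ a₂ b₂ a₃ b₃ a₄ b₄ →
  (a₁ xor b₁) xor (a₂ xor b₂) xor (a₃ xor b₃) xor (a₄ xor b₄)
  ≡ (a₁ xor a₂ xor a₃ xor a₄) xor (b₁ xor b₂ xor b₃ xor b₄)
xor-interchange₄ a₁ b₁ a₂ b₂ a₃ b₃ a₄ b₄ = begin
  (a₁ xor b₁) xor (a₂ xor b₂) xor (a₃ xor b₃) xor (a₄ xor b₄)
    ≡⟨ cong (λ r → (a₁ xor b₁) xor (a₂ xor b₂) xor r) (interchange a₃ b₃ a₄ b₄) ⟩
  (a₁ xor b₁) xor (a₂ xor b₂) xor ((a₃ xor a₄) xor (b₃ xor b₄))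
    ≡⟨ cong ((a₁ xor b₁) xor_) (interchange a₂ b₂ (a₃ xor a₄) (b₃ xor b₄)) ⟩
  (a₁ xor b₁) xor ((a₂ xor a₃ xor a₄) xor (b₂ xor b₃ xor b₄))
    ≡⟨ interchange a₁ b₁ (a₂ xor a₃ xor a₄) (b₂ xor b₃ xor b₄) ⟩
  (a₁ xor a₂ xor a₃ xor a₄) xor (b₁ xor b₂ xor b₃ xor b₄) ∎

xor-sum-self : ∀ x y z → x xor y xor z xor ((x xor y) xor z) ≡ false
xor-sum-self x y z = begin
  x xor y xor z xor w     ≡⟨ cong (x xor_) (sym (xor-assoc y z w)) ⟩
  x xor (y xor z) xor w   ≡⟨ sym (xor-assoc x (y xor z) w) ⟩
  (x xor y xor z) xor w   ≡⟨ cong (_xor w) (sym (xor-assoc x y z)) ⟩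
  w xor w                 ≡⟨ xor-same w ⟩
  false                   ∎
  where w = (x xor y) xor z

take-++ : ∀ {n k} (x : V n) (y : V k) → take n (x ++ y) ≡ x
take-++ [] y = refl
take-++ (a ∷ x) y = cong (a ∷_) (take-++ x y)

drop-++ : ∀ {n k} (x : V n) (y : V k) → drop n (x ++ y) ≡ y
drop-++ [] y = refl
drop-++ (a ∷ x) y = drop-++ x y

·-++ : ∀ {n k} (α x : V n) (β y : V k) → (α ++ β) · (x ++ y) ≡ (α · x) xor (β · y)
·-++ [] [] β y = refl
·-++ (a ∷ α) (b ∷ x) β y =
  trans (cong ((a ∧ b) xor_) (·-++ α x β y)) (sym (xor-assoc (a ∧ b) (α · x) (β · y)))

·-comm : ∀ {n} (x y : V n) → x · y ≡ y · x
·-comm [] [] = refl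
·-comm (a ∷ x) (b ∷ y) = cong₂ _xor_ (∧-comm a b) (·-comm x y)

·-distribˡ-⊕ : ∀ {n} (x u v : V n) → x · (u ⊕ v) ≡ (x · u) xor (x · v)
·-distribˡ-⊕ [] [] [] = refl
·-distribˡ-⊕ (a ∷ x) (b ∷ u) (c ∷ v) = begin
  (a ∧ (b xor c)) xor (x · (u ⊕ v))          ≡⟨ cong₂ _xor_ (∧-distribˡ-xor a b c) (·-distribˡ-⊕ x u v) ⟩
  ((a ∧ b) xor (a ∧ c)) xor (x · u xor x · v) ≡⟨ interchange (a ∧ b) (a ∧ c) (x · u) (x · v) ⟩
  ((a ∧ b) xor x · u) xor ((a ∧ c) xor x · v) ∎

∷ʳ-⊕₃ : ∀ {n} (u v w : V n) b → (u ∷ʳ b) ⊕ (v ∷ʳ b) ⊕ (w ∷ʳ b) ≡ (u ⊕ v ⊕ w) ∷ʳ b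
∷ʳ-⊕₃ [] [] [] false = refl
∷ʳ-⊕₃ [] [] [] true = refl
∷ʳ-⊕₃ (x ∷ u) (y ∷ v) (z ∷ w) b = cong (((x xor y) xor z) ∷_) (∷ʳ-⊕₃ u v w b)

sgn-xor : ∀ a b → sgn (a xor b) ≡ sgn a *ℤ sgn b
sgn-xor false false = refl
sgn-xor false true = refl
sgn-xor true false = refl
sgn-xor true true = refl

sgn+sgn-not : ∀ b → sgn b +ℤ sgn (not b) ≡ + 0
sgn+sgn-not false = refl
sgn+sgn-not true = refl

*-sgn : ∀ K b → K *ℤ sgn b ≡ K ⊎ K *ℤ sgn b ≡ - K
*-sgn K false = inj₁ (*-identityʳ K)
*-sgn K true = inj₂ (trans (sym (neg-distribʳ-* K (+ 1))) (cong -_ (*-identityʳ K)))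

sgn-sum-odd : ∀ e₁ e₂ e₃ e₄ → e₁ xor e₂ xor e₃ xor e₄ ≡ true →
  sgn e₁ +ℤ sgn e₂ +ℤ sgn e₃ +ℤ sgn e₄ ≡ + 2 ⊎ sgn e₁ +ℤ sgn e₂ +ℤ sgn e₃ +ℤ sgn e₄ ≡ - + 2
sgn-sum-odd false false false false ()
sgn-sum-odd false false false true  _ = inj₁ refl
sgn-sum-odd false false true  false _ = inj₁ refl
sgn-sum-odd false false true  true  ()
sgn-sum-odd false true  false false _ = inj₁ refl
sgn-sum-odd false true  false true  ()
sgn-sum-odd false true  true  false ()
sgn-sum-odd false true  true  true  _ = inj₂ refl
sgn-sum-odd true  false false false _ = inj₁ refl
sgn-sum-odd true  false false true  ()
sgn-sum-odd true  false true  false ()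
sgn-sum-odd true  false true  true  _ = inj₂ refl
sgn-sum-odd true  true  false false ()
sgn-sum-odd true  true  false true  _ = inj₂ refl
sgn-sum-odd true  true  true  false _ = inj₂ refl
sgn-sum-odd true  true  true  true  ()

2^n*2≡2^[1+n] : ∀ n → + (2 ^ n) *ℤ + 2 ≡ + (2 ^ suc n)
2^n*2≡2^[1+n] n = trans (sym (pos-* (2 ^ n) 2)) (cong +_ (ℕ.*-comm (2 ^ n) 2))

2^n*±2 : ∀ n {X} → X ≡ + 2 ⊎ X ≡ - + 2 →
  + (2 ^ n) *ℤ X ≡ + (2 ^ suc n) ⊎ + (2 ^ n) *ℤ X ≡ - + (2 ^ suc n)
2^n*±2 n (inj₁ refl) = inj₁ (2^n*2≡2^[1+n] n)
2^n*±2 n (inj₂ refl) = inj₂ (trans (sym (neg-distribʳ-* (+ (2 ^ n)) (+ 2))) (cong -_ (2^n*2≡2^[1+n] n)))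

-- Finite sums

+-interchange : ∀ a b c d → (a +ℤ b) +ℤ (c +ℤ d) ≡ (a +ℤ c) +ℤ (b +ℤ d)
+-interchange = solve-∀

sum : {A : Set} → (A → ℤ) → List A → ℤ
sum F = foldr (λ z s → F z +ℤ s) (+ 0)

sum-cong : ∀ {A : Set} {F G : A → ℤ} → (∀ z → F z ≡ G z) → ∀ xs → sum F xs ≡ sum G xs
sum-cong F≗G [] = refl
sum-cong F≗G (x ∷ xs) = cong₂ _+ℤ_ (F≗G x) (sum-cong F≗G xs)

sum-++ : ∀ {A : Set} (F : A → ℤ) xs ys → sum F (xs ++ᴸ ys) ≡ sum F xs +ℤ sum F ys
sum-++ F [] ys = sym (+-identityˡ (sum F ys))
sum-++ F (x ∷ xs) ys =
  trans (cong (F x +ℤ_) (sum-++ F xs ys)) (sym (+-assoc (F x) (sum F xs) (sum F ys)))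

sum-map : ∀ {A B : Set} (F : B → ℤ) (f : A → B) xs → sum F (map f xs) ≡ sum (F ∘ f) xs
sum-map F f [] = refl
sum-map F f (x ∷ xs) = cong (F (f x) +ℤ_) (sum-map F f xs)

sum-+ : ∀ {A : Set} (F G : A → ℤ) xs → sum (λ z → F z +ℤ G z) xs ≡ sum F xs +ℤ sum G xs
sum-+ F G [] = refl
sum-+ F G (x ∷ xs) =
  trans (cong ((F x +ℤ G x) +ℤ_) (sum-+ F G xs)) (+-interchange (F x) (G x) (sum F xs) (sum G xs))

sum-*ˡ : ∀ {A : Set} (c : ℤ) (F : A → ℤ) xs → sum (λ z → c *ℤ F z) xs ≡ c *ℤ sum F xs
sum-*ˡ c F [] = sym (*-zeroʳ c)
sum-*ˡ c F (x ∷ xs) =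
  trans (cong (c *ℤ F x +ℤ_) (sum-*ˡ c F xs)) (sym (*-distribˡ-+ c (F x) (sum F xs)))

sum-zero : ∀ {A : Set} (xs : List A) → sum (λ _ → + 0) xs ≡ + 0
sum-zero [] = refl
sum-zero (x ∷ xs) = trans (+-identityˡ _) (sum-zero xs)

sum-comm : ∀ {A B : Set} (F : A → B → ℤ) xs ys →
  sum (λ x → sum (F x) ys) xs ≡ sum (λ y → sum (λ x → F x y) xs) ys
sum-comm F [] ys = sym (sum-zero ys)
sum-comm F (x ∷ xs) ys =
  trans (cong (sum (F x) ys +ℤ_) (sum-comm F xs ys))
        (sym (sum-+ (F x) (λ y → sum (λ x′ → F x′ y) xs) ys))

∑ : (N : ℕ) → (V N → ℤ) → ℤ
∑ N F = sum F (allVecs N)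

∑-suc : ∀ N (F : V (suc N) → ℤ) → ∑ (suc N) F ≡ ∑ N (F ∘ (false ∷_)) +ℤ ∑ N (F ∘ (true ∷_))
∑-suc N F = trans (sum-++ F (map (false ∷_) (allVecs N)) (map (true ∷_) (allVecs N)))
  (cong₂ _+ℤ_ (sum-map F (false ∷_) (allVecs N)) (sum-map F (true ∷_) (allVecs N)))

∑-++ : ∀ n k (F : V (n + k) → ℤ) → ∑ (n + k) F ≡ ∑ n (λ x → ∑ k (λ y → F (x ++ y)))
∑-++ zero k F = sym (+-identityʳ (∑ k F))
∑-++ (suc n) k F = begin
  ∑ (suc n + k) F
    ≡⟨ ∑-suc (n + k) F ⟩
  ∑ (n + k) (F ∘ (false ∷_)) +ℤ ∑ (n + k) (F ∘ (true ∷_))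
    ≡⟨ cong₂ _+ℤ_ (∑-++ n k (F ∘ (false ∷_))) (∑-++ n k (F ∘ (true ∷_))) ⟩
  ∑ n (λ x → ∑ k (λ y → F (false ∷ x ++ y))) +ℤ ∑ n (λ x → ∑ k (λ y → F (true ∷ x ++ y)))
    ≡⟨ sym (∑-suc n (λ x → ∑ k (λ y → F (x ++ y)))) ⟩
  ∑ (suc n) (λ x → ∑ k (λ y → F (x ++ y))) ∎

∑-zero : ∀ N {F : V N → ℤ} → (∀ y → F y ≡ + 0) → ∑ N F ≡ + 0
∑-zero N F≗0 = trans (sum-cong F≗0 (allVecs N)) (sum-zero (allVecs N))

∑-delta : ∀ N (F : V N → ℤ) (y₀ : V N) → (∀ y → y ≢ y₀ → F y ≡ + 0) → ∑ N F ≡ F y₀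
∑-delta zero F [] _ = +-identityʳ (F [])
∑-delta (suc N) F (false ∷ y₀) F≗0 =
  trans (∑-suc N F)
        (trans (cong₂ _+ℤ_ (∑-delta N (F ∘ (false ∷_)) y₀ (λ y y≢y₀ → F≗0 _ (y≢y₀ ∘ ∷-injectiveʳ)))
                           (∑-zero N (λ y → F≗0 _ λ ())))
               (+-identityʳ _))
∑-delta (suc N) F (true ∷ y₀) F≗0 =
  trans (∑-suc N F)
        (trans (cong₂ _+ℤ_ (∑-zero N (λ y → F≗0 _ λ ()))
                           (∑-delta N (F ∘ (true ∷_)) y₀ (λ y y≢y₀ → F≗0 _ (y≢y₀ ∘ ∷-injectiveʳ))))
               (+-identityˡ _))

∑-sgn-not : ∀ N (G : V N → Bool) → ∑ N (sgn ∘ G) +ℤ ∑ N (sgn ∘ not ∘ G) ≡ + 0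
∑-sgn-not N G = trans (sym (sum-+ (sgn ∘ G) (sgn ∘ not ∘ G) (allVecs N))) (∑-zero N (sgn+sgn-not ∘ G))

∑-character-self : ∀ {n} (u : V n) → ∑ n (λ x → sgn (x · (u ⊕ u))) ≡ + (2 ^ n)
∑-character-self [] = refl
∑-character-self {suc n} (p ∷ u) = begin
  ∑ (suc n) (λ x → sgn (x · ((p ∷ u) ⊕ (p ∷ u))))
    ≡⟨ ∑-suc n (λ x → sgn (x · ((p ∷ u) ⊕ (p ∷ u)))) ⟩
  S +ℤ ∑ n (λ x → sgn ((p xor p) xor (x · (u ⊕ u))))
    ≡⟨ cong (λ b → S +ℤ ∑ n (λ x → sgn (b xor (x · (u ⊕ u))))) (xor-same p) ⟩
  S +ℤ S
    ≡⟨ cong₂ _+ℤ_ (∑-character-self u) (∑-character-self u) ⟩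
  + (2 ^ n) +ℤ + (2 ^ n)
    ≡⟨ sym (pos-+ (2 ^ n) (2 ^ n)) ⟩
  + (2 ^ n + 2 ^ n)
    ≡⟨ cong (λ k → + (2 ^ n + k)) (sym (ℕ.+-identityʳ (2 ^ n))) ⟩
  + (2 ^ suc n) ∎
  where S = ∑ n (λ x → sgn (x · (u ⊕ u)))

∑-character-≢ : ∀ {n} {u v : V n} → u ≢ v → ∑ n (λ x → sgn (x · (u ⊕ v))) ≡ + 0
∑-character-≢ {u = []} {[]} u≢v = ⊥-elim (u≢v refl)
∑-character-≢ {suc n} {false ∷ u} {false ∷ v} u≢v =
  trans (∑-suc n (λ x → sgn (x · ((false ∷ u) ⊕ (false ∷ v))))) (cong₂ _+ℤ_ IH IH)
  where IH = ∑-character-≢ (u≢v ∘ cong (false ∷_))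
∑-character-≢ {suc n} {true ∷ u} {true ∷ v} u≢v =
  trans (∑-suc n (λ x → sgn (x · ((true ∷ u) ⊕ (true ∷ v))))) (cong₂ _+ℤ_ IH IH)
  where IH = ∑-character-≢ (u≢v ∘ cong (true ∷_))
∑-character-≢ {suc n} {false ∷ u} {true ∷ v} _ =
  trans (∑-suc n (λ x → sgn (x · ((false ∷ u) ⊕ (true ∷ v))))) (∑-sgn-not n (λ x → x · (u ⊕ v)))
∑-character-≢ {suc n} {true ∷ u} {false ∷ v} _ =
  trans (∑-suc n (λ x → sgn (x · ((true ∷ u) ⊕ (false ∷ v))))) (∑-sgn-not n (λ x → x · (u ⊕ v)))

-- Walsh transforms

walsh-cong : ∀ {N} {f g : V N → Bool} → (∀ z → f z ≡ g z) → ∀ a → walsh f a ≡ walsh g a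
walsh-cong {N} f≗g a = sum-cong (λ z → cong (λ b → sgn (b xor (a · z))) (f≗g z)) (allVecs N)

walsh-++ : ∀ {n k} (F : V (n + k) → Bool) (α : V n) (c : V k) →
  walsh F (α ++ c) ≡ ∑ k (λ t → sgn (c · t) *ℤ walsh (λ z → F (z ++ t)) α)
walsh-++ {n} {k} F α c = begin
  walsh F (α ++ c)
    ≡⟨ ∑-++ n k (λ w → sgn (F w xor ((α ++ c) · w))) ⟩
  ∑ n (λ z → ∑ k (λ t → sgn (F (z ++ t) xor ((α ++ c) · (z ++ t)))))
    ≡⟨ sum-comm (λ z t → sgn (F (z ++ t) xor ((α ++ c) · (z ++ t)))) (allVecs n) (allVecs k) ⟩
  ∑ k (λ t → ∑ n (λ z → sgn (F (z ++ t) xor ((α ++ c) · (z ++ t)))))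
    ≡⟨ sum-cong (λ t → sum-cong (λ z → split-sign (F (z ++ t)) z t) (allVecs n)) (allVecs k) ⟩
  ∑ k (λ t → ∑ n (λ z → sgn (c · t) *ℤ sgn (F (z ++ t) xor (α · z))))
    ≡⟨ sum-cong (λ t → sum-*ˡ (sgn (c · t)) _ (allVecs n)) (allVecs k) ⟩
  ∑ k (λ t → sgn (c · t) *ℤ walsh (λ z → F (z ++ t)) α) ∎
  where
    split-sign : ∀ b z t → sgn (b xor ((α ++ c) · (z ++ t))) ≡ sgn (c · t) *ℤ sgn (b xor (α · z))
    split-sign b z t = begin
      sgn (b xor ((α ++ c) · (z ++ t)))   ≡⟨ cong (λ s → sgn (b xor s)) (·-++ α z c t) ⟩
      sgn (b xor (α · z) xor (c · t))     ≡⟨ cong sgn (sym (xor-assoc b (α · z) (c · t))) ⟩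
      sgn ((b xor (α · z)) xor (c · t))   ≡⟨ sgn-xor (b xor (α · z)) (c · t) ⟩
      sgn (b xor (α · z)) *ℤ sgn (c · t)  ≡⟨ *-comm (sgn (b xor (α · z))) (sgn (c · t)) ⟩
      sgn (c · t) *ℤ sgn (b xor (α · z))  ∎

walsh-affine : ∀ {n} (u : V n) (b : Bool) (α : V n) →
  walsh (λ x → (x · u) xor b) α ≡ sgn b *ℤ ∑ n (λ x → sgn (x · (u ⊕ α)))
walsh-affine {n} u b α = trans (sum-cong sign (allVecs n)) (sum-*ˡ (sgn b) _ (allVecs n))
  where
    sign : ∀ x → sgn (((x · u) xor b) xor (α · x)) ≡ sgn b *ℤ sgn (x · (u ⊕ α))
    sign x = begin
      sgn (((x · u) xor b) xor (α · x))  ≡⟨ cong sgn (xy∙z≈y∙xz (x · u) b (α · x)) ⟩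
      sgn (b xor (x · u) xor (α · x))    ≡⟨ cong (λ s → sgn (b xor (x · u) xor s)) (·-comm α x) ⟩
      sgn (b xor (x · u) xor (x · α))    ≡⟨ cong (λ s → sgn (b xor s)) (sym (·-distribˡ-⊕ x u α)) ⟩
      sgn (b xor (x · (u ⊕ α)))          ≡⟨ sgn-xor b (x · (u ⊕ α)) ⟩
      sgn b *ℤ sgn (x · (u ⊕ α))         ∎

record HasDual (n : ℕ) (f f̃ : V (n + n) → Bool) : Set where
  constructor hasDual
  field walsh≡dual : ∀ a → walsh f a ≡ + (2 ^ n) *ℤ sgn (f̃ a)

open HasDual

hasDual⇒bent : ∀ {n} {f f̃ : V (n + n) → Bool} → HasDual n f f̃ → Bent (n + n) f
hasDual⇒bent {n} {f̃ = f̃} dual a rewrite sym (ℕ.n≡⌊n+n/2⌋ n) =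
  map⊎ (trans (walsh≡dual dual a)) (trans (walsh≡dual dual a)) (*-sgn (+ (2 ^ n)) (f̃ a))

-- Maiorana–McFarland functions

mmDual : ∀ {n} → Perm n → (V n → Bool) → V (n + n) → Bool
mmDual {n} φ h a = h y xor (drop n a · y)
  where y = from φ (take n a)

mmFun-++ : ∀ {n} (φ : V n → V n) (h : V n → Bool) (x y : V n) → mmFun φ h (x ++ y) ≡ (x · φ y) xor h y
mmFun-++ φ h x y rewrite take-++ x y | drop-++ x y = refl

walsh-mmFun : ∀ {n} (φ : Perm n) (h : V n → Bool) (α β : V n) →
  walsh (mmFun (to φ) h) (α ++ β) ≡ + (2 ^ n) *ℤ sgn (h (from φ α) xor (β · from φ α))
walsh-mmFun {n} φ h α β = begin
  walsh (mmFun (to φ) h) (α ++ β)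
    ≡⟨ walsh-++ (mmFun (to φ) h) α β ⟩
  ∑ n (λ y → sgn (β · y) *ℤ walsh (λ x → mmFun (to φ) h (x ++ y)) α)
    ≡⟨ sum-cong (λ y → cong (sgn (β · y) *ℤ_) (slice y)) (allVecs n) ⟩
  ∑ n (λ y → sgn (β · y) *ℤ (sgn (h y) *ℤ χ (to φ y)))
    ≡⟨ ∑-delta n _ y₀ off-y₀ ⟩
  sgn (β · y₀) *ℤ (sgn (h y₀) *ℤ χ (to φ y₀))
    ≡⟨ cong (λ u → sgn (β · y₀) *ℤ (sgn (h y₀) *ℤ χ u)) (strictlyInverseˡ φ α) ⟩
  sgn (β · y₀) *ℤ (sgn (h y₀) *ℤ χ α)
    ≡⟨ cong (λ s → sgn (β · y₀) *ℤ (sgn (h y₀) *ℤ s)) (∑-character-self α) ⟩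
  sgn (β · y₀) *ℤ (sgn (h y₀) *ℤ + (2 ^ n))
    ≡⟨ rearrange (sgn (β · y₀)) (sgn (h y₀)) (+ (2 ^ n)) ⟩
  + (2 ^ n) *ℤ (sgn (h y₀) *ℤ sgn (β · y₀))
    ≡⟨ cong (+ (2 ^ n) *ℤ_) (sym (sgn-xor (h y₀) (β · y₀))) ⟩
  + (2 ^ n) *ℤ sgn (h y₀ xor (β · y₀)) ∎
  where
    y₀ = from φ α
    χ : V n → ℤ
    χ u = ∑ n (λ x → sgn (x · (u ⊕ α)))
    slice : ∀ y → walsh (λ x → mmFun (to φ) h (x ++ y)) α ≡ sgn (h y) *ℤ χ (to φ y)
    slice y = trans (walsh-cong (λ x → mmFun-++ (to φ) h x y) α) (walsh-affine (to φ y) (h y) α)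
    off-y₀ : ∀ y → y ≢ y₀ → sgn (β · y) *ℤ (sgn (h y) *ℤ χ (to φ y)) ≡ + 0
    off-y₀ y y≢y₀ = begin
      sgn (β · y) *ℤ (sgn (h y) *ℤ χ (to φ y))
        ≡⟨ cong (λ s → sgn (β · y) *ℤ (sgn (h y) *ℤ s)) (∑-character-≢ φy≢α) ⟩
      sgn (β · y) *ℤ (sgn (h y) *ℤ + 0)
        ≡⟨ cong (sgn (β · y) *ℤ_) (*-zeroʳ (sgn (h y))) ⟩
      sgn (β · y) *ℤ + 0
        ≡⟨ *-zeroʳ (sgn (β · y)) ⟩
      + 0 ∎
      where φy≢α : to φ y ≢ α
            φy≢α e = y≢y₀ (trans (sym (strictlyInverseʳ φ y)) (cong (from φ) e))
    rearrange : ∀ s t K → s *ℤ (t *ℤ K) ≡ K *ℤ (t *ℤ s)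
    rearrange = solve-∀

mmFun-hasDual : ∀ {n} (φ : Perm n) (h : V n → Bool) → HasDual n (mmFun (to φ) h) (mmDual φ h)
mmFun-hasDual {n} φ h = hasDual walsh≡
  where
    walsh≡ : ∀ a → walsh (mmFun (to φ) h) a ≡ + (2 ^ n) *ℤ sgn (mmDual φ h a)
    walsh≡ a with splitAt n a
    ... | α , β , refl = walsh-mmFun φ h α β

-- Concatenation of four functions

concat4-corners : ∀ {N} (g₁ g₂ g₃ g₄ : V N → Bool) (z : V N) →
    concat4 g₁ g₂ g₃ g₄ (z ++ false ∷ false ∷ []) ≡ g₁ z
  × concat4 g₁ g₂ g₃ g₄ (z ++ false ∷ true ∷ []) ≡ g₂ z
  × concat4 g₁ g₂ g₃ g₄ (z ++ true ∷ false ∷ []) ≡ g₃ z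
  × concat4 g₁ g₂ g₃ g₄ (z ++ true ∷ true ∷ []) ≡ g₄ z
concat4-corners g₁ g₂ g₃ g₄ z
  rewrite take-++ z (false ∷ false ∷ []) | drop-++ z (false ∷ false ∷ [])
        | take-++ z (false ∷ true ∷ []) | drop-++ z (false ∷ true ∷ [])
        | take-++ z (true ∷ false ∷ []) | drop-++ z (true ∷ false ∷ [])
        | take-++ z (true ∷ true ∷ []) | drop-++ z (true ∷ true ∷ []) =
  xor-identityʳ x₁ ,
  trans (cong (x₁ xor_) (xor-identityʳ (x₁ xor x₂))) (xor-cancelˡ x₁ x₂) ,
  trans (cong (x₁ xor_) (xor-identityʳ (x₁ xor x₃))) (xor-cancelˡ x₁ x₃) ,
  corner₁₁
  where
    x₁ = g₁ z
    x₂ = g₂ z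
    x₃ = g₃ z
    x₄ = g₄ z
    corner₁₁ : x₁ xor (x₁ xor x₃) xor (x₁ xor x₂) xor (x₁ xor x₂ xor x₃ xor x₄) ≡ x₄
    corner₁₁ = begin
      x₁ xor (x₁ xor x₃) xor (x₁ xor x₂) xor (x₁ xor x₂ xor x₃ xor x₄)
        ≡⟨ cong (λ r → x₁ xor (x₁ xor x₃) xor r) (sym (cong ((x₁ xor x₂) xor_) (xor-assoc x₁ x₂ _))) ⟩
      x₁ xor (x₁ xor x₃) xor (x₁ xor x₂) xor ((x₁ xor x₂) xor x₃ xor x₄)
        ≡⟨ cong (λ r → x₁ xor (x₁ xor x₃) xor r) (xor-cancelˡ (x₁ xor x₂) (x₃ xor x₄)) ⟩
      x₁ xor (x₁ xor x₃) xor x₃ xor x₄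
        ≡⟨ cong (x₁ xor_) (xor-assoc x₁ x₃ (x₃ xor x₄)) ⟩
      x₁ xor x₁ xor x₃ xor x₃ xor x₄
        ≡⟨ xor-cancelˡ x₁ _ ⟩
      x₃ xor x₃ xor x₄
        ≡⟨ xor-cancelˡ x₃ x₄ ⟩
      x₄ ∎

∑₂ : ∀ (F : V 2 → ℤ) →
  ∑ 2 F ≡ F (false ∷ false ∷ []) +ℤ F (false ∷ true ∷ []) +ℤ F (true ∷ false ∷ []) +ℤ F (true ∷ true ∷ [])
∑₂ F = reassoc (F (false ∷ false ∷ [])) (F (false ∷ true ∷ [])) (F (true ∷ false ∷ [])) (F (true ∷ true ∷ []))
  where reassoc : ∀ a b c d → a +ℤ (b +ℤ (c +ℤ (d +ℤ + 0))) ≡ a +ℤ b +ℤ c +ℤ d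
        reassoc = solve-∀

walsh-concat4 : ∀ {N} (g₁ g₂ g₃ g₄ : V N → Bool) (α : V N) (c₁ c₂ : Bool) →
  walsh (concat4 g₁ g₂ g₃ g₄) (α ++ c₁ ∷ c₂ ∷ [])
  ≡ walsh g₁ α +ℤ sgn c₂ *ℤ walsh g₂ α +ℤ sgn c₁ *ℤ walsh g₃ α +ℤ sgn (c₁ xor c₂) *ℤ walsh g₄ α
walsh-concat4 g₁ g₂ g₃ g₄ α c₁ c₂ = begin
  walsh (concat4 g₁ g₂ g₃ g₄) (α ++ c)
    ≡⟨ walsh-++ (concat4 g₁ g₂ g₃ g₄) α c ⟩
  ∑ 2 term
    ≡⟨ ∑₂ term ⟩
  term t₀₀ +ℤ term t₀₁ +ℤ term t₁₀ +ℤ term t₁₁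
    ≡⟨ cong₂ _+ℤ_ (cong₂ _+ℤ_ (cong₂ _+ℤ_ (trans (corner t₀₀ (·-comm c t₀₀) corner₀₀) (*-identityˡ _))
                                          (corner t₀₁ (trans (·-comm c t₀₁) (xor-identityʳ c₂)) corner₀₁))
                              (corner t₁₀ (trans (·-comm c t₁₀) (xor-identityʳ c₁)) corner₁₀))
                  (corner t₁₁ (trans (·-comm c t₁₁) (cong (c₁ xor_) (xor-identityʳ c₂))) corner₁₁) ⟩
  walsh g₁ α +ℤ sgn c₂ *ℤ walsh g₂ α +ℤ sgn c₁ *ℤ walsh g₃ α +ℤ sgn (c₁ xor c₂) *ℤ walsh g₄ α ∎
  where
    c t₀₀ t₀₁ t₁₀ t₁₁ : V 2
    c = c₁ ∷ c₂ ∷ []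
    t₀₀ = false ∷ false ∷ []
    t₀₁ = false ∷ true ∷ []
    t₁₀ = true ∷ false ∷ []
    t₁₁ = true ∷ true ∷ []
    term : V 2 → ℤ
    term t = sgn (c · t) *ℤ walsh (λ z → concat4 g₁ g₂ g₃ g₄ (z ++ t)) α
    corner : ∀ t {s} {g : V _ → Bool} → c · t ≡ s → (∀ z → concat4 g₁ g₂ g₃ g₄ (z ++ t) ≡ g z) →
             term t ≡ sgn s *ℤ walsh g α
    corner t c·t≡s restrict≗g = cong₂ _*ℤ_ (cong sgn c·t≡s) (walsh-cong restrict≗g α)
    corner₀₀ = λ z → proj₁ (concat4-corners g₁ g₂ g₃ g₄ z)
    corner₀₁ = λ z → proj₁ (proj₂ (concat4-corners g₁ g₂ g₃ g₄ z))
    corner₁₀ = λ z → proj₁ (proj₂ (proj₂ (concat4-corners g₁ g₂ g₃ g₄ z)))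
    corner₁₁ = λ z → proj₂ (proj₂ (proj₂ (concat4-corners g₁ g₂ g₃ g₄ z)))

walsh-concat4-dual : ∀ {n} {f₁ f₂ f₃ f₄ f̃₁ f̃₂ f̃₃ f̃₄ : V (n + n) → Bool} →
  HasDual n f₁ f̃₁ → HasDual n f₂ f̃₂ → HasDual n f₃ f̃₃ → HasDual n f₄ f̃₄ →
  ∀ α c₁ c₂ → walsh (concat4 f₁ f₂ f₃ f₄) (α ++ c₁ ∷ c₂ ∷ [])
  ≡ + (2 ^ n) *ℤ (sgn (f̃₁ α) +ℤ sgn (c₂ xor f̃₂ α) +ℤ sgn (c₁ xor f̃₃ α) +ℤ sgn ((c₁ xor c₂) xor f̃₄ α))
walsh-concat4-dual {n} {f₁} {f₂} {f₃} {f₄} {f̃₁} {f̃₂} {f̃₃} {f̃₄} d₁ d₂ d₃ d₄ α c₁ c₂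
  rewrite walsh-concat4 f₁ f₂ f₃ f₄ α c₁ c₂
        | walsh≡dual d₁ α | walsh≡dual d₂ α | walsh≡dual d₃ α | walsh≡dual d₄ α
        | sgn-xor c₂ (f̃₂ α) | sgn-xor c₁ (f̃₃ α) | sgn-xor (c₁ xor c₂) (f̃₄ α) =
  factor (+ (2 ^ n)) (sgn (f̃₁ α)) (sgn (f̃₂ α)) (sgn (f̃₃ α)) (sgn (f̃₄ α)) (sgn c₂) (sgn c₁) (sgn (c₁ xor c₂))
  where
    factor : ∀ K a b c d x y z →
      K *ℤ a +ℤ x *ℤ (K *ℤ b) +ℤ y *ℤ (K *ℤ c) +ℤ z *ℤ (K *ℤ d) ≡ K *ℤ (a +ℤ x *ℤ b +ℤ y *ℤ c +ℤ z *ℤ d)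
    factor = solve-∀

⌊n+n+2/2⌋≡1+n : ∀ n → ⌊ (n + n) + 2 /2⌋ ≡ suc n
⌊n+n+2/2⌋≡1+n n = trans (cong ⌊_/2⌋ (ℕ.+-comm (n + n) 2)) (cong suc (sym (ℕ.n≡⌊n+n/2⌋ n)))

concat4-bent : ∀ {n} {f₁ f₂ f₃ f₄ f̃₁ f̃₂ f̃₃ f̃₄ : V (n + n) → Bool} →
  HasDual n f₁ f̃₁ → HasDual n f₂ f̃₂ → HasDual n f₃ f̃₃ → HasDual n f₄ f̃₄ →
  (∀ a → f̃₁ a xor f̃₂ a xor f̃₃ a xor f̃₄ a ≡ true) →
  Bent ((n + n) + 2) (concat4 f₁ f₂ f₃ f₄)
concat4-bent {n} {f₁} {f₂} {f₃} {f₄} {f̃₁} {f̃₂} {f̃₃} {f̃₄} d₁ d₂ d₃ d₄ odd a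
  rewrite ⌊n+n+2/2⌋≡1+n n with splitAt (n + n) a
... | α , c₁ ∷ c₂ ∷ [] , refl =
  map⊎ (trans walsh≡) (trans walsh≡)
       (2^n*±2 n (sgn-sum-odd (f̃₁ α) (c₂ xor f̃₂ α) (c₁ xor f̃₃ α) ((c₁ xor c₂) xor f̃₄ α) parity))
  where
    walsh≡ = walsh-concat4-dual {n} {f₁} {f₂} {f₃} {f₄} {f̃₁} {f̃₂} {f̃₃} {f̃₄} d₁ d₂ d₃ d₄ α c₁ c₂
    parity : f̃₁ α xor (c₂ xor f̃₂ α) xor (c₁ xor f̃₃ α) xor ((c₁ xor c₂) xor f̃₄ α) ≡ true
    parity = trans (xor-interchange₄ false (f̃₁ α) c₂ (f̃₂ α) c₁ (f̃₃ α) (c₁ xor c₂) (f̃₄ α))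
                   (trans (cong (_xor (f̃₁ α xor f̃₂ α xor f̃₃ α xor f̃₄ α))
                                (trans (cong (c₂ xor_) (xor-cancelˡ c₁ c₂)) (xor-same c₂)))
                          (odd α))

mmDual-sum : ∀ {n} (φ₁ φ₂ φ₃ φ₄ : Perm n) (h₁ h₂ h₃ h₄ : V n → Bool) →
  (∀ y → from φ₄ y ≡ from φ₁ y ⊕ from φ₂ y ⊕ from φ₃ y) →
  (∀ y → h₁ (from φ₁ y) xor h₂ (from φ₂ y) xor h₃ (from φ₃ y) xor h₄ (from φ₄ y) ≡ true) →
  ∀ a → mmDual φ₁ h₁ a xor mmDual φ₂ h₂ a xor mmDual φ₃ h₃ a xor mmDual φ₄ h₄ a ≡ true
mmDual-sum {n} φ₁ φ₂ φ₃ φ₄ h₁ h₂ h₃ h₄ from-sum h-sum a =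
  trans (xor-interchange₄ (h₁ u₁) (β · u₁) (h₂ u₂) (β · u₂) (h₃ u₃) (β · u₃) (h₄ u₄) (β · u₄))
        (cong₂ _xor_ (h-sum α) linear-part)
  where
    α = take n a
    β = drop n a
    u₁ = from φ₁ α
    u₂ = from φ₂ α
    u₃ = from φ₃ α
    u₄ = from φ₄ α
    linear-part : β · u₁ xor β · u₂ xor β · u₃ xor β · u₄ ≡ false
    linear-part = begin
      β · u₁ xor β · u₂ xor β · u₃ xor β · u₄
        ≡⟨ cong (λ u → β · u₁ xor β · u₂ xor β · u₃ xor β · u) (from-sum α) ⟩
      β · u₁ xor β · u₂ xor β · u₃ xor β · (u₁ ⊕ u₂ ⊕ u₃)
        ≡⟨ cong (λ b → β · u₁ xor β · u₂ xor β · u₃ xor b)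
                (trans (·-distribˡ-⊕ β (u₁ ⊕ u₂) u₃) (cong (_xor β · u₃) (·-distribˡ-⊕ β u₁ u₂))) ⟩
      β · u₁ xor β · u₂ xor β · u₃ xor ((β · u₁ xor β · u₂) xor β · u₃)
        ≡⟨ xor-sum-self (β · u₁) (β · u₂) (β · u₃) ⟩
      false ∎

-- Gluing two permutations of 𝔽₂ᵐ into one of 𝔽₂ᵐ⁺¹

glueFun-⊕ : ∀ {m} (F₁ F₂ F₃ F₄ G₁ G₂ G₃ G₄ : V m → V m) →
  (∀ y → F₄ y ≡ F₁ y ⊕ F₂ y ⊕ F₃ y) → (∀ y → G₄ y ≡ G₁ y ⊕ G₂ y ⊕ G₃ y) →
  ∀ w → glueFun F₄ G₄ w ≡ glueFun F₁ G₁ w ⊕ glueFun F₂ G₂ w ⊕ glueFun F₃ G₃ w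
glueFun-⊕ F₁ F₂ F₃ F₄ G₁ G₂ G₃ G₄ F-sum G-sum w = step-⊕ (last w) (init w)
  where
    step-⊕ : ∀ b y → step F₄ G₄ b y ≡ step F₁ G₁ b y ⊕ step F₂ G₂ b y ⊕ step F₃ G₃ b y
    step-⊕ true y = trans (cong (_∷ʳ true) (F-sum y)) (sym (∷ʳ-⊕₃ (F₁ y) (F₂ y) (F₃ y) true))
    step-⊕ false y = trans (cong (_∷ʳ false) (G-sum y)) (sym (∷ʳ-⊕₃ (G₁ y) (G₂ y) (G₃ y) false))

liftFun-step-true : ∀ {m} (h g : V m → Bool) (F G : V m → V m) y → liftFun h g (step F G true y) ≡ h (F y)
liftFun-step-true h g F G y rewrite last-∷ʳ true (F y) | init-∷ʳ true (F y) = xor-identityʳ (h (F y))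

liftFun-step-false : ∀ {m} (h g : V m → Bool) (F G : V m → V m) y → liftFun h g (step F G false y) ≡ g (G y)
liftFun-step-false h g F G y rewrite last-∷ʳ false (G y) | init-∷ʳ false (G y) = refl

liftFun-sum : ∀ {m} (h₁ h₂ h₃ h₄ g₁ g₂ g₃ g₄ : V m → Bool) (F₁ F₂ F₃ F₄ G₁ G₂ G₃ G₄ : V m → V m) →
  (∀ y → h₁ (F₁ y) xor h₂ (F₂ y) xor h₃ (F₃ y) xor h₄ (F₄ y) ≡ true) →
  (∀ y → g₁ (G₁ y) xor g₂ (G₂ y) xor g₃ (G₃ y) xor g₄ (G₄ y) ≡ true) →
  ∀ w → liftFun h₁ g₁ (glueFun F₁ G₁ w) xor liftFun h₂ g₂ (glueFun F₂ G₂ w)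
        xor liftFun h₃ g₃ (glueFun F₃ G₃ w) xor liftFun h₄ g₄ (glueFun F₄ G₄ w) ≡ true
liftFun-sum h₁ h₂ h₃ h₄ g₁ g₂ g₃ g₄ F₁ F₂ F₃ F₄ G₁ G₂ G₃ G₄ h-sum g-sum w = step-sum (last w) (init w)
  where
    step-sum : ∀ b y → liftFun h₁ g₁ (step F₁ G₁ b y) xor liftFun h₂ g₂ (step F₂ G₂ b y)
                       xor liftFun h₃ g₃ (step F₃ G₃ b y) xor liftFun h₄ g₄ (step F₄ G₄ b y) ≡ true
    step-sum true y
      rewrite liftFun-step-true h₁ g₁ F₁ G₁ y | liftFun-step-true h₂ g₂ F₂ G₂ y
            | liftFun-step-true h₃ g₃ F₃ G₃ y | liftFun-step-true h₄ g₄ F₄ G₄ y = h-sum y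
    step-sum false y
      rewrite liftFun-step-false h₁ g₁ F₁ G₁ y | liftFun-step-false h₂ g₂ F₂ G₂ y
            | liftFun-step-false h₃ g₃ F₃ G₃ y | liftFun-step-false h₄ g₄ F₄ G₄ y = g-sum y

proposition2 :
  (m : ℕ) (π₁ π₂ π₃ σ₁ σ₂ σ₃ : Perm m)
  (Aπ : PropertyA π₁ π₂ π₃) (Aσ : PropertyA σ₁ σ₂ σ₃)
  (h₁ h₂ h₃ h₄ g₁ g₂ g₃ g₄ : V m → Bool) →
  let π₄ = proj₁ Aπ
      σ₄ = proj₁ Aσ
      φ₁ = glue π₁ σ₁
      φ₂ = glue π₂ σ₂
      φ₃ = glue π₃ σ₃
      φ₄ = glue π₄ σ₄
      h₁′ = liftFun h₁ g₁
      h₂′ = liftFun h₂ g₂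
      h₃′ = liftFun h₃ g₃
      h₄′ = liftFun h₄ g₄
      f₁′ = mmFun (Inverse.to φ₁) h₁′
      f₂′ = mmFun (Inverse.to φ₂) h₂′
      f₃′ = mmFun (Inverse.to φ₃) h₃′
      f₄′ = mmFun (Inverse.to φ₄) h₄′
  in (∀ y → h₁ (Inverse.from π₁ y) xor h₂ (Inverse.from π₂ y)
            xor h₃ (Inverse.from π₃ y) xor h₄ (Inverse.from π₄ y) ≡ true) →
     (∀ y → g₁ (Inverse.from σ₁ y) xor g₂ (Inverse.from σ₂ y)
            xor g₃ (Inverse.from σ₃ y) xor g₄ (Inverse.from σ₄ y) ≡ true) →
     ((∀ w → Inverse.to φ₄ w ≡ Inverse.to φ₁ w ⊕ Inverse.to φ₂ w ⊕ Inverse.to φ₃ w)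
      × (∀ w → h₁′ (Inverse.from φ₁ w) xor h₂′ (Inverse.from φ₂ w)
               xor h₃′ (Inverse.from φ₃ w) xor h₄′ (Inverse.from φ₄ w) ≡ true))
     × ((Bent (suc m + suc m) f₁′ × Bent (suc m + suc m) f₂′
         × Bent (suc m + suc m) f₃′ × Bent (suc m + suc m) f₄′)
        × Bent ((suc m + suc m) + 2) (concat4 f₁′ f₂′ f₃′ f₄′))
proposition2 m π₁ π₂ π₃ σ₁ σ₂ σ₃ (π₄ , π-to , π-from) (σ₄ , σ-to , σ-from)
             h₁ h₂ h₃ h₄ g₁ g₂ g₃ g₄ h-sum g-sum =
  (to-sum , h′-sum) ,
  (hasDual⇒bent (mmFun-hasDual φ₁ h₁′) , hasDual⇒bent (mmFun-hasDual φ₂ h₂′) ,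
   hasDual⇒bent (mmFun-hasDual φ₃ h₃′) , hasDual⇒bent (mmFun-hasDual φ₄ h₄′)) ,
  concat4-bent (mmFun-hasDual φ₁ h₁′) (mmFun-hasDual φ₂ h₂′)
                       (mmFun-hasDual φ₃ h₃′) (mmFun-hasDual φ₄ h₄′)
                       (mmDual-sum φ₁ φ₂ φ₃ φ₄ h₁′ h₂′ h₃′ h₄′ from-sum h′-sum)
  where
    φ₁ = glue π₁ σ₁
    φ₂ = glue π₂ σ₂
    φ₃ = glue π₃ σ₃
    φ₄ = glue π₄ σ₄
    h₁′ = liftFun h₁ g₁
    h₂′ = liftFun h₂ g₂
    h₃′ = liftFun h₃ g₃
    h₄′ = liftFun h₄ g₄
    to-sum = glueFun-⊕ (to π₁) (to π₂) (to π₃) (to π₄) (to σ₁) (to σ₂) (to σ₃) (to σ₄) π-to σ-to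
    from-sum = glueFun-⊕ (from π₁) (from π₂) (from π₃) (from π₄)
                         (from σ₁) (from σ₂) (from σ₃) (from σ₄) π-from σ-from
    h′-sum = liftFun-sum h₁ h₂ h₃ h₄ g₁ g₂ g₃ g₄ (from π₁) (from π₂) (from π₃) (from π₄)
                         (from σ₁) (from σ₂) (from σ₃) (from σ₄) h-sum g-sum
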